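{- Let $G$ be a mixed graph on a finite vertex set with $n \geq 2$ vertices, with $E_1$ its set of non-edges, $E_2$ its set of non-oriented edges, $E_3$ its set of oriented edges, and $\overline{E_3}$ the set $E_3$ with all orientations reversed. Let $N_\emptyset$ be the number of permutations $\mathbf{x}$ of $G$ with $E(\mathbf{x}) \subseteq E_1\cup E_2\cup E_3$, and let $N_{=\emptyset}$ be the number of permutations $\mathbf{x}$ of $G$ with $E(\mathbf{x}) \cap (E_1\cup E_2\cup \overline{E_3}) = \emptyset$. Then $N_\emptyset$ and $N_{=\emptyset}$ have the same parity; hence the number of permutations of $G$ containing at least one element of $E_1\cup E_2$ but no element of $\overline{E_3}$ is even.
   Context: A mixed graph $G$ on a finite vertex set $V$: each unordered pair of distinct vertices is exactly one of: a non-edge (the set of these is $E_1$), a non-oriented edge (the set of these is $E_2$), or an oriented edge in one of the two possible directions (the set of these ordered pairs is $E_3$). $\overline{E_3}=\{(y,x) : (x,y)\in E_3\}$. A permutation of $G$ is an ordering $\mathbf{x}=(x_1,\dots,x_n)$ of all vertices of $G$. For $1\le i\le n-1$, the neighboring pair of $x_i,x_{i+1}$ is the unordered pair $\{x_i,x_{i+1}\}$ if this pair lies in $E_1\cup E_2$, and otherwise it is the ordered pair $(x_i,x_{i+1})$, which then lies in $E_3$ or in $\overline{E_3}$. $E(\mathbf{x})$ denotes the set of the $n-1$ neighboring pairs of $\mathbf{x}$, and $\mathbf{x}$ contains $e$ if $e\in E(\mathbf{x})$. -}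

module Defs where

open import Data.Nat using (ℕ; zero; suc)
open import Data.Fin using (Fin)
open import Data.Fin.Properties using () renaming (_≟_ to _≟F_)
open import Data.List using (List; []; _∷_; map; concatMap; length; filter; allFin)
open import Data.List.Relation.Unary.All using (All; all?)
open import Data.List.Relation.Unary.Any using (Any; any?)
import Data.List.Relation.Unary.Unique.DecPropositional as UniqueDec
open import Data.Product using (_×_; _,_)
open import Relation.Binary.PropositionalEquality using (_≡_; _≢_)
open import Relation.Nullary using (Dec; yes; no; ¬_; ¬?)
open import Relation.Nullary.Decidable using (_×-dec_; _⊎-dec_)
open import Data.Sum using (_⊎_)

-- Type of an ordered pair (x , y) of distinct vertices:
--   nonEdge    : {x,y} ∈ E₁
--   undirected : {x,y} ∈ E₂
--   forward    : (x,y) ∈ E₃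
--   backward   : (y,x) ∈ E₃, i.e. (x,y) ∈ E₃‾
data EdgeKind : Set where
  nonEdge undirected forward backward : EdgeKind

reverseKind : EdgeKind → EdgeKind
reverseKind nonEdge    = nonEdge
reverseKind undirected = undirected
reverseKind forward    = backward
reverseKind backward   = forward

-- A mixed graph on the vertex set Fin n.  The value of `kind` on the diagonal is irrelevant.
record MixedGraph (n : ℕ) : Set where
  field
    kind      : Fin n → Fin n → EdgeKind
    kind-flip : ∀ x y → x ≢ y → kind y x ≡ reverseKind (kind x y)
open MixedGraph public

allLists : (n k : ℕ) → List (List (Fin n))
allLists n zero    = [] ∷ []
allLists n (suc k) = concatMap (λ xs → map (_∷ xs) (allFin n)) (allLists n k)

permutations : (n : ℕ) → List (List (Fin n))
permutations n = filter (UniqueDec.unique? (_≟F_ {n})) (allLists n n)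

adjPairs : {A : Set} → List A → List (A × A)
adjPairs []           = []
adjPairs (x ∷ [])     = []
adjPairs (x ∷ y ∷ xs) = (x , y) ∷ adjPairs (y ∷ xs)

isBackward : EdgeKind → Set
isBackward k = k ≡ backward

isBackward? : (k : EdgeKind) → Dec (isBackward k)
isBackward? nonEdge    = no λ ()
isBackward? undirected = no λ ()
isBackward? forward    = no λ ()
isBackward? backward   = yes _≡_.refl

isForward? : (k : EdgeKind) → Dec (k ≡ forward)
isForward? nonEdge    = no λ ()
isForward? undirected = no λ ()
isForward? forward    = yes _≡_.refl
isForward? backward   = no λ ()

inE₁₂? : (k : EdgeKind) → Dec (k ≡ nonEdge ⊎ k ≡ undirected)
inE₁₂? nonEdge    = yes (Data.Sum.inj₁ _≡_.refl)
inE₁₂? undirected = yes (Data.Sum.inj₂ _≡_.refl)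
inE₁₂? forward    = no λ { (Data.Sum.inj₁ ()) ; (Data.Sum.inj₂ ()) }
inE₁₂? backward   = no λ { (Data.Sum.inj₁ ()) ; (Data.Sum.inj₂ ()) }

module _ {n : ℕ} (G : MixedGraph n) where

  -- E(x) ⊆ E₁ ∪ E₂ ∪ E₃  (no neighboring pair lies in E₃‾)
  NoReversed : List (Fin n) → Set
  NoReversed xs = All (λ { (a , b) → ¬ isBackward (kind G a b) }) (adjPairs xs)

  noReversed? : ∀ xs → Dec (NoReversed xs)
  noReversed? xs = all? (λ { (a , b) → ¬? (isBackward? (kind G a b)) }) (adjPairs xs)

  -- E(x) ∩ (E₁ ∪ E₂ ∪ E₃‾) = ∅  (every neighboring pair lies in E₃)
  AllForward : List (Fin n) → Set
  AllForward xs = All (λ { (a , b) → kind G a b ≡ forward }) (adjPairs xs)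

  allForward? : ∀ xs → Dec (AllForward xs)
  allForward? xs = all? (λ { (a , b) → isForward? (kind G a b) }) (adjPairs xs)

  SomeE₁₂ : List (Fin n) → Set
  SomeE₁₂ xs = Any (λ { (a , b) → kind G a b ≡ nonEdge ⊎ kind G a b ≡ undirected }) (adjPairs xs)

  someE₁₂? : ∀ xs → Dec (SomeE₁₂ xs)
  someE₁₂? xs = any? (λ { (a , b) → inE₁₂? (kind G a b) }) (adjPairs xs)

  N∅ : ℕ
  N∅ = length (filter noReversed? (permutations n))

  N=∅ : ℕ
  N=∅ = length (filter allForward? (permutations n))

  Nmixed : ℕ
  Nmixed = length (filter (λ xs → someE₁₂? xs ×-dec noReversed? xs) (permutations n))

-- Weight each ordering x of the vertices by 2 ^ b(x), where b(x) is the number of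
-- its neighbouring pairs lying in E₃‾; the weight is odd exactly when x is counted
-- by N∅, so the weighted count has the parity of N∅.  The weight 2 ^ b(x) is the
-- number of ways of cutting x into consecutive blocks all of whose neighbouring
-- pairs lie in E₃‾ ("backward paths").  Cuttings into a single block are the
-- reverses of the permutations counted by N=∅.  On cuttings into at least two
-- blocks, exchanging the first two blocks is a fixed-point-free involution, so
-- these are even in number.  Finally N∅ = N=∅ + Nmixed.

module Submission where

open import Defs
open import Data.Bool using (Bool; true; false; not; _∧_; _xor_; if_then_else_)
open import Data.Bool.Properties using (not-involutive; not-distribˡ-xor; xor-same; xor-identityʳ)
open import Data.Fin using (Fin)
open import Data.Fin.Properties using () renaming (_≟_ to _≟ᶠ_)
open import Data.List using (List; []; _∷_; _++_; _∷ʳ_; map; concatMap; allFin; filter; length; null; reverse)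
open import Data.List.Properties using (unfold-reverse)
open import Data.List.Membership.Propositional.Properties using (∈-++⁺ʳ)
open import Data.List.Relation.Unary.Any using (here)
open import Data.List.Relation.Unary.All.Properties using (All¬⇒¬Any; ¬Any⇒All¬)
open import Data.List.Relation.Unary.AllPairs using (_∷_)
open import Data.List.Relation.Unary.All as All using (_∷_)
open import Data.List.Relation.Unary.Unique.Propositional using (Unique)
open import Data.List.Relation.Unary.Unique.Propositional.Properties using (Unique[x∷xs]⇒x∉xs)
import Data.List.Relation.Unary.Unique.DecPropositional as UniqueDec
open import Data.List.Relation.Binary.Permutation.Propositional using (_↭_; ↭-sym; ↭⇒↭ₛ)
open import Data.List.Relation.Binary.Permutation.Propositional.Properties using (shifts; ↭-reverse)
import Data.List.Relation.Binary.Permutation.Setoid.Properties as Permutationₛ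
open import Data.Nat using (ℕ; zero; suc; _+_; _*_; _≤_; _%_)
open import Data.Nat.Properties
open import Data.Nat.Divisibility using (_∣_; divides)
open import Data.Product using (_×_; _,_)
open import Data.Sum using (_⊎_; inj₁; inj₂)
open import Function using (flip; mk⇔)
open import Relation.Binary.PropositionalEquality
open import Relation.Nullary using (Dec; yes; no; ¬_; does; contradiction)
open import Relation.Nullary.Decidable using (_×-dec_; dec-false; does-⇔)
open import Algebra.Properties.CommutativeSemigroup +-commutativeSemigroup
  using () renaming (interchange to +-interchange)
open import Algebra.Properties.CommutativeSemigroup *-commutativeSemigroup
  using () renaming (x∙yz≈y∙xz to *-left-comm)

private variable
  A B C P Q R : Set

-- Parity and indicators

𝟙ᵇ : Bool → ℕ
𝟙ᵇ b = if b then 1 else 0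

parity : ℕ → Bool
parity zero    = false
parity (suc n) = not (parity n)

parity-+ : ∀ m n → parity (m + n) ≡ parity m xor parity n
parity-+ zero    n = refl
parity-+ (suc m) n = trans (cong not (parity-+ m n)) (not-distribˡ-xor (parity m) (parity n))

parity-* : ∀ m n → parity (m * n) ≡ parity m ∧ parity n
parity-* zero    n = refl
parity-* (suc m) n = begin
  parity (n + m * n)                ≡⟨ parity-+ n (m * n) ⟩
  parity n xor parity (m * n)       ≡⟨ cong (parity n xor_) (parity-* m n) ⟩
  parity n xor (parity m ∧ parity n) ≡⟨ xor-∧-absorb (parity m) (parity n) ⟩
  not (parity m) ∧ parity n         ∎
  where
  open ≡-Reasoning
  xor-∧-absorb : ∀ x y → y xor (x ∧ y) ≡ not x ∧ y
  xor-∧-absorb true  y = xor-same y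
  xor-∧-absorb false y = xor-identityʳ y

parity-+-cancelˡ : ∀ m n → parity (m + n) ≡ parity m → parity n ≡ false
parity-+-cancelˡ m n eq with parity m | parity n | trans (sym (parity-+ m n)) eq
... | true  | false | _  = refl
... | false | false | _  = refl
... | true  | true  | ()
... | false | true  | ()

%2≡parity : ∀ n → n % 2 ≡ 𝟙ᵇ (parity n)
%2≡parity zero          = refl
%2≡parity (suc zero)    = refl
%2≡parity (suc (suc n)) =
  trans (%2≡parity n) (cong 𝟙ᵇ (sym (not-involutive (parity n))))

parity≡⇒%2≡ : ∀ m n → parity m ≡ parity n → m % 2 ≡ n % 2
parity≡⇒%2≡ m n eq =
  trans (%2≡parity m) (trans (cong 𝟙ᵇ eq) (sym (%2≡parity n)))

parity≡false⇒2∣ : ∀ n → parity n ≡ false → 2 ∣ n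
parity≡false⇒2∣ zero          _  = divides 0 refl
parity≡false⇒2∣ (suc (suc n)) eq with parity≡false⇒2∣ n (trans (sym (not-involutive (parity n))) eq)
... | divides q n≡q*2 = divides (suc q) (cong (λ m → suc (suc m)) n≡q*2)

𝟙 : Dec P → ℕ
𝟙 P? = 𝟙ᵇ (does P?)

parity-𝟙 : (P? : Dec P) → parity (𝟙 P?) ≡ does P?
parity-𝟙 P? with does P?
... | true  = refl
... | false = refl

𝟙-×-dec : (P? : Dec P) (Q? : Dec Q) → 𝟙 (P? ×-dec Q?) ≡ 𝟙 P? * 𝟙 Q?
𝟙-×-dec P? Q? with does P?
... | true  = sym (+-identityʳ (𝟙 Q?))
... | false = refl

𝟙-no : (P? : Dec P) → ¬ P → 𝟙 P? ≡ 0
𝟙-no P? ¬p = cong 𝟙ᵇ (dec-false P? ¬p)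

𝟙-⇔ : (P? : Dec P) (Q? : Dec Q) → (P → Q) → (Q → P) → 𝟙 P? ≡ 𝟙 Q?
𝟙-⇔ P? Q? to from = cong 𝟙ᵇ (does-⇔ (mk⇔ to from) P? Q?)

𝟙-*-cong : (P? : Dec P) {x y : ℕ} → (P → x ≡ y) → 𝟙 P? * x ≡ 𝟙 P? * y
𝟙-*-cong (yes p) x≡y = cong (_+ 0) (x≡y p)
𝟙-*-cong (no _)  _   = refl

𝟙-partition : (P? : Dec P) (Q? : Dec Q) (R? : Dec R) →
  (Q → P) → (Q → ¬ R) → (P → ¬ R → Q) → 𝟙 P? ≡ 𝟙 Q? + 𝟙 (R? ×-dec P?)
𝟙-partition (yes _) (yes _) (no _)  _   _    _    = refl
𝟙-partition (yes _) (yes q) (yes r) _   q⇒¬r _    = contradiction r (q⇒¬r q)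
𝟙-partition (yes _) (no _)  (yes _) _   _    _    = refl
𝟙-partition (yes p) (no ¬q) (no ¬r) _   _    back = contradiction (back p ¬r) ¬q
𝟙-partition (no ¬p) (yes q) _       q⇒p _    _    = contradiction (q⇒p q) ¬p
𝟙-partition (no _)  (no _)  (yes _) _   _    _    = refl
𝟙-partition (no _)  (no _)  (no _)  _   _    _    = refl

-- Sums over lists, antidiagonals and splittings

∑ : List B → (B → ℕ) → ℕ
∑ []       f = 0
∑ (x ∷ xs) f = f x + ∑ xs f

infix 5 ∑
syntax ∑ L (λ x → e) = ∑[ x ← L ] e

∑-cong : ∀ (L : List B) {f g : B → ℕ} → (∀ x → f x ≡ g x) → ∑ L f ≡ ∑ L g
∑-cong []       _   = refl
∑-cong (x ∷ xs) f≗g = cong₂ _+_ (f≗g x) (∑-cong xs f≗g)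

∑-0 : ∀ (L : List B) → ∑[ _ ← L ] 0 ≡ 0
∑-0 []       = refl
∑-0 (_ ∷ xs) = ∑-0 xs

∑-+ : ∀ (L : List B) (f g : B → ℕ) → ∑[ x ← L ] (f x + g x) ≡ ∑ L f + ∑ L g
∑-+ []       f g = refl
∑-+ (x ∷ xs) f g = trans (cong (f x + g x +_) (∑-+ xs f g)) (+-interchange (f x) (g x) _ _)

∑-++ : ∀ (L M : List B) (f : B → ℕ) → ∑ (L ++ M) f ≡ ∑ L f + ∑ M f
∑-++ []       M f = refl
∑-++ (x ∷ xs) M f = trans (cong (f x +_) (∑-++ xs M f)) (sym (+-assoc (f x) _ _))

∑-map : ∀ (h : B → C) (L : List B) (f : C → ℕ) → ∑ (map h L) f ≡ ∑[ x ← L ] f (h x)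
∑-map h []       f = refl
∑-map h (x ∷ xs) f = cong (f (h x) +_) (∑-map h xs f)

∑-concatMap : ∀ (h : B → List C) (L : List B) (f : C → ℕ) →
  ∑ (concatMap h L) f ≡ ∑[ x ← L ] ∑ (h x) f
∑-concatMap h []       f = refl
∑-concatMap h (x ∷ xs) f = trans (∑-++ (h x) (concatMap h xs) f) (cong (∑ (h x) f +_) (∑-concatMap h xs f))

∑-comm : ∀ (L : List B) (M : List C) (f : B → C → ℕ) →
  ∑[ x ← L ] ∑[ y ← M ] f x y ≡ ∑[ y ← M ] ∑[ x ← L ] f x y
∑-comm []       M f = sym (∑-0 M)
∑-comm (x ∷ xs) M f =
  trans (cong (∑ M (f x) +_) (∑-comm xs M f)) (sym (∑-+ M (f x) (λ y → ∑[ x′ ← xs ] f x′ y)))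

length-filter : ∀ {P : B → Set} (P? : ∀ x → Dec (P x)) (L : List B) →
  length (filter P? L) ≡ ∑[ x ← L ] 𝟙 (P? x)
length-filter P? []       = refl
length-filter P? (x ∷ xs) with does (P? x)
... | true  = cong suc (length-filter P? xs)
... | false = length-filter P? xs

∑-filter : ∀ {P : B → Set} (P? : ∀ x → Dec (P x)) (L : List B) (f : B → ℕ) →
  ∑ (filter P? L) f ≡ ∑[ x ← L ] 𝟙 (P? x) * f x
∑-filter P? []       f = refl
∑-filter P? (x ∷ xs) f with does (P? x)
... | true  = cong₂ _+_ (sym (+-identityʳ (f x))) (∑-filter P? xs f)
... | false = ∑-filter P? xs f

parity-∑-cong : ∀ (L : List B) {f g : B → ℕ} →
  (∀ x → parity (f x) ≡ parity (g x)) → parity (∑ L f) ≡ parity (∑ L g)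
parity-∑-cong []       _ = refl
parity-∑-cong (x ∷ xs) {f} {g} eq = begin
  parity (f x + ∑ xs f)           ≡⟨ parity-+ (f x) _ ⟩
  parity (f x) xor parity (∑ xs f) ≡⟨ cong₂ _xor_ (eq x) (parity-∑-cong xs eq) ⟩
  parity (g x) xor parity (∑ xs g) ≡⟨ parity-+ (g x) _ ⟨
  parity (g x + ∑ xs g)           ∎
  where open ≡-Reasoning

parity-∑²-symmetric : ∀ (L : List B) (Φ : B → B → ℕ) →
  (∀ x y → Φ x y ≡ Φ y x) → (∀ x → parity (Φ x x) ≡ false) →
  parity (∑[ x ← L ] ∑[ y ← L ] Φ x y) ≡ false
parity-∑²-symmetric []       Φ sym-Φ diag = refl
parity-∑²-symmetric (a ∷ xs) Φ sym-Φ diag = begin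
  parity ((Φ a a + X) + (∑[ x ← xs ] (Φ x a + (∑[ y ← xs ] Φ x y))))
    ≡⟨ cong (λ t → parity ((Φ a a + X) + t)) (∑-+ xs (λ x → Φ x a) (λ x → ∑[ y ← xs ] Φ x y)) ⟩
  parity ((Φ a a + X) + ((∑[ x ← xs ] Φ x a) + Y))
    ≡⟨ cong (λ t → parity ((Φ a a + X) + (t + Y))) (∑-cong xs (λ x → sym-Φ x a)) ⟩
  parity ((Φ a a + X) + (X + Y))
    ≡⟨ trans (parity-+ (Φ a a + X) (X + Y)) (cong₂ _xor_ (parity-+ (Φ a a) X) (parity-+ X Y)) ⟩
  (parity (Φ a a) xor parity X) xor (parity X xor parity Y)
    ≡⟨ cong₂ (λ d r → (d xor parity X) xor (parity X xor r)) (diag a) (parity-∑²-symmetric xs Φ sym-Φ diag) ⟩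
  parity X xor (parity X xor false)
    ≡⟨ cong (parity X xor_) (xor-identityʳ (parity X)) ⟩
  parity X xor parity X
    ≡⟨ xor-same (parity X) ⟩
  false ∎
  where
  open ≡-Reasoning
  X : ℕ
  X = ∑[ y ← xs ] Φ a y
  Y : ℕ
  Y = ∑[ x ← xs ] ∑[ y ← xs ] Φ x y

∑-antidiagonal : ℕ → (ℕ → ℕ → ℕ) → ℕ
∑-antidiagonal zero    g = g 0 0
∑-antidiagonal (suc m) g = g 0 (suc m) + ∑-antidiagonal m (λ j k → g (suc j) k)

infix 5 ∑-antidiagonal
syntax ∑-antidiagonal m (λ j k → e) = ∑[ j + k ≡ m ] e

∑-antidiagonal-cong : ∀ m {f g : ℕ → ℕ → ℕ} → (∀ j k → f j k ≡ g j k) →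
  ∑-antidiagonal m f ≡ ∑-antidiagonal m g
∑-antidiagonal-cong zero    f≗g = f≗g 0 0
∑-antidiagonal-cong (suc m) f≗g = cong₂ _+_ (f≗g 0 (suc m)) (∑-antidiagonal-cong m (λ j → f≗g (suc j)))

∑-antidiagonal-+ : ∀ m (f g : ℕ → ℕ → ℕ) →
  ∑[ j + k ≡ m ] (f j k + g j k) ≡ ∑-antidiagonal m f + ∑-antidiagonal m g
∑-antidiagonal-+ zero    f g = refl
∑-antidiagonal-+ (suc m) f g =
  trans (cong (f 0 (suc m) + g 0 (suc m) +_) (∑-antidiagonal-+ m (λ j → f (suc j)) (λ j → g (suc j))))
        (+-interchange (f 0 (suc m)) (g 0 (suc m)) _ _)

∑-∑-antidiagonal : ∀ (L : List A) m (g : A → ℕ → ℕ → ℕ) →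
  ∑[ x ← L ] ∑-antidiagonal m (g x) ≡ ∑[ j + k ≡ m ] ∑[ x ← L ] g x j k
∑-∑-antidiagonal []       m g = sym (∑-antidiagonal-0 m)
  where
  ∑-antidiagonal-0 : ∀ m → ∑[ j + k ≡ m ] 0 ≡ 0
  ∑-antidiagonal-0 zero    = refl
  ∑-antidiagonal-0 (suc m) = ∑-antidiagonal-0 m
∑-∑-antidiagonal (x ∷ xs) m g =
  trans (cong (∑-antidiagonal m (g x) +_) (∑-∑-antidiagonal xs m g)) (sym (∑-antidiagonal-+ m (g x) _))

∑-antidiagonal-suc-last : ∀ m (g : ℕ → ℕ → ℕ) →
  ∑-antidiagonal (suc m) g ≡ (∑[ j + k ≡ m ] g j (suc k)) + g (suc m) 0
∑-antidiagonal-suc-last zero    g = refl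
∑-antidiagonal-suc-last (suc m) g =
  trans (cong (g 0 (suc (suc m)) +_) (∑-antidiagonal-suc-last m (λ j → g (suc j))))
        (sym (+-assoc (g 0 (suc (suc m))) _ _))

-- Both sides sum Ψ j j′ k over all j + j′ + k ≡ m.
∑-antidiagonal-assoc : ∀ m (Ψ : ℕ → ℕ → ℕ → ℕ) →
  ∑[ j + k ≡ m ] ∑[ j′ + k′ ≡ k ] Ψ j j′ k′ ≡ ∑[ s + k ≡ m ] ∑[ j + j′ ≡ s ] Ψ j j′ k
∑-antidiagonal-assoc zero    Ψ = refl
∑-antidiagonal-assoc (suc m) Ψ = begin
  (Ψ 0 0 (suc m) + A₀) + (∑[ j + k ≡ m ] ∑[ j′ + k′ ≡ k ] Ψ (suc j) j′ k′)
    ≡⟨ cong ((Ψ 0 0 (suc m) + A₀) +_) (∑-antidiagonal-assoc m (λ j → Ψ (suc j))) ⟩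
  (Ψ 0 0 (suc m) + A₀) + (∑[ s + k ≡ m ] ∑[ j + j′ ≡ s ] Ψ (suc j) j′ k)
    ≡⟨ +-assoc (Ψ 0 0 (suc m)) _ _ ⟩
  Ψ 0 0 (suc m) + (A₀ + (∑[ s + k ≡ m ] ∑[ j + j′ ≡ s ] Ψ (suc j) j′ k))
    ≡⟨ cong (Ψ 0 0 (suc m) +_) (∑-antidiagonal-+ m (λ s k → Ψ 0 (suc s) k) _) ⟨
  Ψ 0 0 (suc m) + (∑[ s + k ≡ m ] (Ψ 0 (suc s) k + (∑[ j + j′ ≡ s ] Ψ (suc j) j′ k)))
    ∎
  where
  open ≡-Reasoning
  A₀ : ℕ
  A₀ = ∑[ j′ + k′ ≡ m ] Ψ 0 (suc j′) k′

parity-∑-antidiagonal-even : ∀ m (g : ℕ → ℕ → ℕ) →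
  (∀ j k → parity (g j k) ≡ false) → parity (∑-antidiagonal m g) ≡ false
parity-∑-antidiagonal-even zero    g even = even 0 0
parity-∑-antidiagonal-even (suc m) g even =
  trans (parity-+ (g 0 (suc m)) _)
        (cong₂ _xor_ (even 0 (suc m)) (parity-∑-antidiagonal-even m (λ j → g (suc j)) (λ j → even (suc j))))

parity-∑-antidiagonal-symmetric : ∀ m (g : ℕ → ℕ → ℕ) →
  (∀ j k → g j k ≡ g k j) → (∀ j → parity (g j j) ≡ false) → parity (∑-antidiagonal m g) ≡ false
parity-∑-antidiagonal-symmetric zero          g sym-g diag = diag 0
parity-∑-antidiagonal-symmetric (suc zero)    g sym-g diag =
  trans (parity-+ (g 0 1) (g 1 0))
        (trans (cong (λ t → parity (g 0 1) xor parity t) (sym-g 1 0)) (xor-same (parity (g 0 1))))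
parity-∑-antidiagonal-symmetric (suc (suc m)) g sym-g diag = begin
  parity (g 0 (2 + m) + ∑-antidiagonal (suc m) (λ j → g (suc j)))
    ≡⟨ cong (λ t → parity (g 0 (2 + m) + t)) (∑-antidiagonal-suc-last m (λ j → g (suc j))) ⟩
  parity (g 0 (2 + m) + (inner + g (2 + m) 0))
    ≡⟨ trans (parity-+ (g 0 (2 + m)) _) (cong (parity (g 0 (2 + m)) xor_) (parity-+ inner _)) ⟩
  parity (g 0 (2 + m)) xor (parity inner xor parity (g (2 + m) 0))
    ≡⟨ cong₂ (λ i t → parity (g 0 (2 + m)) xor (i xor parity t)) inner-even (sym-g (2 + m) 0) ⟩
  parity (g 0 (2 + m)) xor parity (g 0 (2 + m))
    ≡⟨ xor-same (parity (g 0 (2 + m))) ⟩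
  false ∎
  where
  open ≡-Reasoning
  inner : ℕ
  inner = ∑[ j + k ≡ m ] g (suc j) (suc k)
  inner-even : parity inner ≡ false
  inner-even = parity-∑-antidiagonal-symmetric m (λ j k → g (suc j) (suc k))
                 (λ j k → sym-g (suc j) (suc k)) (λ j → diag (suc j))

∑-splits : (List A → List A → ℕ) → List A → ℕ
∑-splits H []      = H [] []
∑-splits H (a ∷ w) = H [] (a ∷ w) + ∑-splits (λ p s → H (a ∷ p) s) w

infix 5 ∑-splits
syntax ∑-splits (λ p s → e) w = ∑[ p ++ s ≡ w ] e

∑-splits-cong : ∀ (w : List A) {f g : List A → List A → ℕ} →
  (∀ p s → f p s ≡ g p s) → ∑-splits f w ≡ ∑-splits g w
∑-splits-cong []      f≗g = f≗g [] []
∑-splits-cong (a ∷ w) f≗g = cong₂ _+_ (f≗g [] (a ∷ w)) (∑-splits-cong w (λ p → f≗g (a ∷ p)))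

∑-splits-+ : ∀ (w : List A) (f g : List A → List A → ℕ) →
  ∑[ p ++ s ≡ w ] (f p s + g p s) ≡ ∑-splits f w + ∑-splits g w
∑-splits-+ []      f g = refl
∑-splits-+ (a ∷ w) f g =
  trans (cong (f [] (a ∷ w) + g [] (a ∷ w) +_) (∑-splits-+ w (λ p → f (a ∷ p)) (λ p → g (a ∷ p))))
        (+-interchange (f [] (a ∷ w)) (g [] (a ∷ w)) _ _)

∑-splits-null : ∀ (w : List A) (h : List A → ℕ) → ∑[ p ++ s ≡ w ] h p * 𝟙ᵇ (null s) ≡ h w
∑-splits-null []      h = *-identityʳ (h [])
∑-splits-null (a ∷ w) h =
  trans (cong (_+ (∑[ p ++ s ≡ w ] h (a ∷ p) * 𝟙ᵇ (null s))) (*-zeroʳ (h [])))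
        (∑-splits-null w (λ p → h (a ∷ p)))

*-∑-splits : ∀ (w : List A) (c : List A → ℕ) (f : List A → List A → ℕ) →
  c w * ∑-splits f w ≡ ∑[ p ++ s ≡ w ] c (p ++ s) * f p s
*-∑-splits []      c f = refl
*-∑-splits (a ∷ w) c f =
  trans (*-distribˡ-+ (c (a ∷ w)) (f [] (a ∷ w)) _)
        (cong (c (a ∷ w) * f [] (a ∷ w) +_) (*-∑-splits w (λ x → c (a ∷ x)) (λ p → f (a ∷ p))))

∏-adjacent : (A → A → ℕ) → List A → ℕ
∏-adjacent g []          = 1
∏-adjacent g (a ∷ [])    = 1
∏-adjacent g (a ∷ b ∷ w) = g a b * ∏-adjacent g (b ∷ w)

∏-adjacent-∷ʳ : ∀ (g : A → A → ℕ) w b a → ∏-adjacent g (w ∷ʳ b ∷ʳ a) ≡ ∏-adjacent g (w ∷ʳ b) * g b a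
∏-adjacent-∷ʳ g []          b a = trans (*-identityʳ (g b a)) (sym (+-identityʳ (g b a)))
∏-adjacent-∷ʳ g (c ∷ [])    b a = trans (cong (g c b *_) (∏-adjacent-∷ʳ g [] b a)) (sym (*-assoc (g c b) _ _))
∏-adjacent-∷ʳ g (c ∷ d ∷ w) b a =
  trans (cong (g c d *_) (∏-adjacent-∷ʳ g (d ∷ w) b a)) (sym (*-assoc (g c d) _ _))

∏-adjacent-reverse : ∀ (g : A → A → ℕ) w → ∏-adjacent g (reverse w) ≡ ∏-adjacent (flip g) w
∏-adjacent-reverse g []          = refl
∏-adjacent-reverse g (a ∷ [])    = refl
∏-adjacent-reverse g (a ∷ b ∷ w) = begin
  ∏-adjacent g (reverse (a ∷ b ∷ w))
    ≡⟨ cong (∏-adjacent g) (trans (unfold-reverse a (b ∷ w)) (cong (_∷ʳ a) (unfold-reverse b w))) ⟩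
  ∏-adjacent g (reverse w ∷ʳ b ∷ʳ a)       ≡⟨ ∏-adjacent-∷ʳ g (reverse w) b a ⟩
  ∏-adjacent g (reverse w ∷ʳ b) * g b a    ≡⟨ cong (λ x → ∏-adjacent g x * g b a) (unfold-reverse b w) ⟨
  ∏-adjacent g (reverse (b ∷ w)) * g b a   ≡⟨ cong (_* g b a) (∏-adjacent-reverse g (b ∷ w)) ⟩
  ∏-adjacent (flip g) (b ∷ w) * g b a      ≡⟨ *-comm _ (g b a) ⟩
  ∏-adjacent (flip g) (a ∷ b ∷ w)          ∎
  where open ≡-Reasoning

∏-adjacent-cong-≢ : ∀ {g h : A → A → ℕ} {w} → (∀ a b → a ≢ b → g a b ≡ h a b) →
  Unique w → ∏-adjacent g w ≡ ∏-adjacent h w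
∏-adjacent-cong-≢ {w = []}          g≗h u = refl
∏-adjacent-cong-≢ {w = a ∷ []}      g≗h u = refl
∏-adjacent-cong-≢ {w = a ∷ b ∷ w}   g≗h ((a≢b ∷ _) ∷ u) =
  cong₂ _*_ (g≗h a b a≢b) (∏-adjacent-cong-≢ g≗h u)

module _ {n : ℕ} where

  ∑-allLists-suc : ∀ m (f : List (Fin n) → ℕ) →
    ∑ (allLists n (suc m)) f ≡ ∑[ w ← allLists n m ] ∑[ a ← allFin n ] f (a ∷ w)
  ∑-allLists-suc m f = trans (∑-concatMap (λ w → map (_∷ w) (allFin n)) (allLists n m) f)
                             (∑-cong (allLists n m) (λ w → ∑-map (_∷ w) (allFin n) f))

  ∑-allLists-suc-∷ʳ : ∀ m (f : List (Fin n) → ℕ) →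
    ∑ (allLists n (suc m)) f ≡ ∑[ w ← allLists n m ] ∑[ a ← allFin n ] f (w ∷ʳ a)
  ∑-allLists-suc-∷ʳ zero    f = ∑-allLists-suc zero f
  ∑-allLists-suc-∷ʳ (suc m) f = begin
    ∑ (allLists n (2 + m)) f
      ≡⟨ ∑-allLists-suc (suc m) f ⟩
    ∑[ w ← allLists n (suc m) ] ∑[ a ← allFin n ] f (a ∷ w)
      ≡⟨ ∑-allLists-suc-∷ʳ m (λ w → ∑[ a ← allFin n ] f (a ∷ w)) ⟩
    ∑[ w ← allLists n m ] ∑[ b ← allFin n ] ∑[ a ← allFin n ] f (a ∷ (w ∷ʳ b))
      ≡⟨ ∑-cong (allLists n m) (λ w → ∑-comm (allFin n) (allFin n) (λ b a → f (a ∷ (w ∷ʳ b)))) ⟩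
    ∑[ w ← allLists n m ] ∑[ a ← allFin n ] ∑[ b ← allFin n ] f ((a ∷ w) ∷ʳ b)
      ≡⟨ ∑-allLists-suc m (λ w → ∑[ b ← allFin n ] f (w ∷ʳ b)) ⟨
    ∑[ w ← allLists n (suc m) ] ∑[ b ← allFin n ] f (w ∷ʳ b)
      ∎
    where open ≡-Reasoning

  ∑-allLists-reverse : ∀ m (f : List (Fin n) → ℕ) →
    ∑[ w ← allLists n m ] f (reverse w) ≡ ∑ (allLists n m) f
  ∑-allLists-reverse zero    f = refl
  ∑-allLists-reverse (suc m) f = begin
    ∑[ w ← allLists n (suc m) ] f (reverse w)
      ≡⟨ ∑-allLists-suc m (λ w → f (reverse w)) ⟩
    ∑[ w ← allLists n m ] ∑[ a ← allFin n ] f (reverse (a ∷ w))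
      ≡⟨ ∑-cong (allLists n m) (λ w → ∑-cong (allFin n) (λ a → cong f (unfold-reverse a w))) ⟩
    ∑[ w ← allLists n m ] ∑[ a ← allFin n ] f (reverse w ∷ʳ a)
      ≡⟨ ∑-allLists-reverse m (λ w → ∑[ a ← allFin n ] f (w ∷ʳ a)) ⟩
    ∑[ w ← allLists n m ] ∑[ a ← allFin n ] f (w ∷ʳ a)
      ≡⟨ ∑-allLists-suc-∷ʳ m f ⟨
    ∑ (allLists n (suc m)) f
      ∎
    where open ≡-Reasoning

  ∑-allLists-splits : ∀ m (H : List (Fin n) → List (Fin n) → ℕ) →
    ∑[ w ← allLists n m ] ∑-splits H w ≡
    ∑[ j + k ≡ m ] ∑[ p ← allLists n j ] ∑[ s ← allLists n k ] H p s
  ∑-allLists-splits zero    H = trans (+-identityʳ (H [] [])) (sym (trans (+-identityʳ _) (+-identityʳ _)))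
  ∑-allLists-splits (suc m) H = begin
    ∑[ w ← allLists n (suc m) ] ∑-splits H w
      ≡⟨ ∑-allLists-suc m (∑-splits H) ⟩
    ∑[ w ← allLists n m ] ∑[ a ← allFin n ] (H [] (a ∷ w) + ∑-splits (λ p → H (a ∷ p)) w)
      ≡⟨ trans (∑-cong (allLists n m) (λ w → ∑-+ (allFin n) _ _)) (∑-+ (allLists n m) _ _) ⟩
    (∑[ w ← allLists n m ] ∑[ a ← allFin n ] H [] (a ∷ w))
      + (∑[ w ← allLists n m ] ∑[ a ← allFin n ] ∑-splits (λ p → H (a ∷ p)) w)
      ≡⟨ cong₂ _+_ (trans (+-identityʳ _) (∑-allLists-suc m (H []))) (∑-comm (allFin n) (allLists n m) _) ⟨
    first + (∑[ a ← allFin n ] ∑[ w ← allLists n m ] ∑-splits (λ p → H (a ∷ p)) w)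
      ≡⟨ cong (first +_) (∑-cong (allFin n) (λ a → ∑-allLists-splits m (λ p → H (a ∷ p)))) ⟩
    first + (∑[ a ← allFin n ] ∑[ j + k ≡ m ] ∑[ p ← allLists n j ] ∑[ s ← allLists n k ] H (a ∷ p) s)
      ≡⟨ cong (first +_) (∑-∑-antidiagonal (allFin n) m _) ⟩
    first + (∑[ j + k ≡ m ] ∑[ a ← allFin n ] ∑[ p ← allLists n j ] ∑[ s ← allLists n k ] H (a ∷ p) s)
      ≡⟨ cong (first +_) (∑-antidiagonal-cong m (λ j k →
           trans (∑-comm (allFin n) (allLists n j) _) (sym (∑-allLists-suc j (λ p → ∑[ s ← allLists n k ] H p s))))) ⟩
    first + (∑[ j + k ≡ m ] ∑[ p ← allLists n (suc j) ] ∑[ s ← allLists n k ] H p s)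
      ∎
    where
    open ≡-Reasoning
    first : ℕ
    first = ∑[ p ← allLists n 0 ] ∑[ s ← allLists n (suc m) ] H p s

  -- Swapping the first two blocks of p ++ q ++ r pairs the terms off.
  parity-∑-allLists-splits²-symmetric : ∀ m (F : List (Fin n) → List (Fin n) → List (Fin n) → ℕ) →
    (∀ p q r → F p q r ≡ F q p r) → (∀ p r → F p p r ≡ 0) →
    parity (∑[ w ← allLists n m ] ∑[ p ++ s ≡ w ] ∑[ q ++ r ≡ s ] F p q r) ≡ false
  parity-∑-allLists-splits²-symmetric m F F-sym F-diag =
    trans (cong parity regroup)
          (parity-∑-antidiagonal-even m _ (λ s k →
             parity-∑-antidiagonal-symmetric s (λ j j′ → Ψ j j′ k) (λ j j′ → Ψ-sym j j′ k) (λ j → Ψ-diag j k)))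
    where
    open ≡-Reasoning
    Ψ : ℕ → ℕ → ℕ → ℕ
    Ψ j j′ k = ∑[ p ← allLists n j ] ∑[ q ← allLists n j′ ] ∑[ r ← allLists n k ] F p q r

    regroup : ∑[ w ← allLists n m ] ∑[ p ++ s ≡ w ] ∑[ q ++ r ≡ s ] F p q r ≡
              ∑[ s + k ≡ m ] ∑[ j + j′ ≡ s ] Ψ j j′ k
    regroup = begin
      ∑[ w ← allLists n m ] ∑[ p ++ s ≡ w ] ∑-splits (F p) s
        ≡⟨ ∑-allLists-splits m (λ p → ∑-splits (F p)) ⟩
      ∑[ j + k ≡ m ] ∑[ p ← allLists n j ] ∑[ s ← allLists n k ] ∑-splits (F p) s
        ≡⟨ ∑-antidiagonal-cong m (λ j k → ∑-cong (allLists n j) (λ p → ∑-allLists-splits k (F p))) ⟩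
      ∑[ j + k ≡ m ] ∑[ p ← allLists n j ] ∑[ j′ + k′ ≡ k ] ∑[ q ← allLists n j′ ] ∑[ r ← allLists n k′ ] F p q r
        ≡⟨ ∑-antidiagonal-cong m (λ j k → ∑-∑-antidiagonal (allLists n j) k _) ⟩
      ∑[ j + k ≡ m ] ∑[ j′ + k′ ≡ k ] Ψ j j′ k′
        ≡⟨ ∑-antidiagonal-assoc m Ψ ⟩
      ∑[ s + k ≡ m ] ∑[ j + j′ ≡ s ] Ψ j j′ k
        ∎

    Ψ-sym : ∀ j j′ k → Ψ j j′ k ≡ Ψ j′ j k
    Ψ-sym j j′ k = trans (∑-comm (allLists n j) (allLists n j′) _)
      (∑-cong (allLists n j′) (λ q → ∑-cong (allLists n j) (λ p → ∑-cong (allLists n k) (F-sym p q))))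

    Ψ-diag : ∀ j k → parity (Ψ j j k) ≡ false
    Ψ-diag j k = parity-∑²-symmetric (allLists n j) (λ p q → ∑ (allLists n k) (F p q))
      (λ p q → ∑-cong (allLists n k) (F-sym p q))
      (λ p → cong parity (trans (∑-cong (allLists n k) (F-diag p)) (∑-0 (allLists n k))))

module _ {n : ℕ} where
  open UniqueDec (_≟ᶠ_ {n}) using (unique?)

  isUnique : List (Fin n) → ℕ
  isUnique w = 𝟙 (unique? w)

  isUnique-↭ : ∀ {w w′} → w ↭ w′ → isUnique w ≡ isUnique w′
  isUnique-↭ w↭w′ = 𝟙-⇔ (unique? _) (unique? _)
    (Permutationₛ.Unique-resp-↭ (setoid (Fin n)) (↭⇒↭ₛ w↭w′))
    (Permutationₛ.Unique-resp-↭ (setoid (Fin n)) (↭⇒↭ₛ (↭-sym w↭w′)))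

  isUnique-repeat : ∀ a p s → isUnique (a ∷ p ++ a ∷ s) ≡ 0
  isUnique-repeat a p s = 𝟙-no (unique? _) (λ u → Unique[x∷xs]⇒x∉xs u (∈-++⁺ʳ p (here refl)))

  length-filter-permutations : ∀ {P : List (Fin n) → Set} (P? : ∀ w → Dec (P w)) →
    length (filter P? (permutations n)) ≡ ∑[ w ← allLists n n ] isUnique w * 𝟙 (P? w)
  length-filter-permutations P? =
    trans (length-filter P? (permutations n)) (∑-filter unique? (allLists n n) (λ w → 𝟙 (P? w)))

𝟙-isForward?-reverseKind : ∀ k → 𝟙 (isForward? (reverseKind k)) ≡ 𝟙 (isBackward? k)
𝟙-isForward?-reverseKind nonEdge    = refl
𝟙-isForward?-reverseKind undirected = refl
𝟙-isForward?-reverseKind forward    = refl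
𝟙-isForward?-reverseKind backward   = refl

forward⇒¬backward : ∀ {k} → k ≡ forward → ¬ isBackward k
forward⇒¬backward refl ()

forward⇒¬E₁₂ : ∀ {k} → k ≡ forward → ¬ (k ≡ nonEdge ⊎ k ≡ undirected)
forward⇒¬E₁₂ refl (inj₁ ())
forward⇒¬E₁₂ refl (inj₂ ())

¬backward⇒¬E₁₂⇒forward : ∀ {k} → ¬ isBackward k → ¬ (k ≡ nonEdge ⊎ k ≡ undirected) → k ≡ forward
¬backward⇒¬E₁₂⇒forward {nonEdge}    _     ¬E₁₂ = contradiction (inj₁ refl) ¬E₁₂
¬backward⇒¬E₁₂⇒forward {undirected} _     ¬E₁₂ = contradiction (inj₂ refl) ¬E₁₂
¬backward⇒¬E₁₂⇒forward {forward}    _     _    = refl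
¬backward⇒¬E₁₂⇒forward {backward}   ¬back _    = contradiction refl ¬back

-- Path covers

module _ {n : ℕ} (G : MixedGraph n) where

  bwd fwd : Fin n → Fin n → ℕ
  bwd a b = 𝟙 (isBackward? (kind G a b))
  fwd a b = 𝟙 (isForward? (kind G a b))

  fwd-flip : ∀ a b → a ≢ b → fwd b a ≡ bwd a b
  fwd-flip a b a≢b =
    trans (cong (λ k → 𝟙 (isForward? k)) (kind-flip G a b a≢b)) (𝟙-isForward?-reverseKind (kind G a b))

  backwardPath : List (Fin n) → ℕ
  backwardPath []      = 0
  backwardPath (a ∷ w) = ∏-adjacent bwd (a ∷ w)

  -- The number of ways to cut w into backward paths: 2 ^ (number of backward adjacent pairs).
  pathCovers : List (Fin n) → ℕ
  pathCovers = ∏-adjacent (λ a b → 1 + bwd a b)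

  parity-pathCovers : ∀ w → parity (pathCovers w) ≡ does (noReversed? G w)
  parity-pathCovers []          = refl
  parity-pathCovers (a ∷ [])    = refl
  parity-pathCovers (a ∷ b ∷ w) =
    trans (parity-* (1 + bwd a b) (pathCovers (b ∷ w)))
          (cong₂ (λ x y → not x ∧ y) (parity-𝟙 (isBackward? (kind G a b))) (parity-pathCovers (b ∷ w)))

  𝟙-allForward? : ∀ w → 𝟙 (allForward? G w) ≡ ∏-adjacent fwd w
  𝟙-allForward? []          = refl
  𝟙-allForward? (a ∷ [])    = refl
  𝟙-allForward? (a ∷ b ∷ w) =
    trans (𝟙-×-dec (isForward? (kind G a b)) (allForward? G (b ∷ w))) (cong (fwd a b *_) (𝟙-allForward? (b ∷ w)))

  pathCovers-first : ∀ a w → pathCovers (a ∷ w) ≡ ∑[ p ++ s ≡ w ] backwardPath (a ∷ p) * pathCovers s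
  pathCovers-first a []      = refl
  pathCovers-first a (b ∷ w) = cong₂ _+_ (sym (*-identityˡ (pathCovers (b ∷ w)))) (begin
    bwd a b * pathCovers (b ∷ w)
      ≡⟨ cong (bwd a b *_) (pathCovers-first b w) ⟩
    bwd a b * (∑[ p ++ s ≡ w ] backwardPath (b ∷ p) * pathCovers s)
      ≡⟨ *-∑-splits w (λ _ → bwd a b) _ ⟩
    ∑[ p ++ s ≡ w ] bwd a b * (backwardPath (b ∷ p) * pathCovers s)
      ≡⟨ ∑-splits-cong w (λ p s → *-assoc (bwd a b) _ _) ⟨
    ∑[ p ++ s ≡ w ] backwardPath (a ∷ b ∷ p) * pathCovers s
      ∎)
    where open ≡-Reasoning

  pathCovers-split : ∀ w → pathCovers w ≡ 𝟙ᵇ (null w) + (∑[ p ++ s ≡ w ] backwardPath p * pathCovers s)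
  pathCovers-split []      = refl
  pathCovers-split (a ∷ w) = pathCovers-first a w

  pathCovers-two-paths : ∀ w → pathCovers w ≡
    ∏-adjacent bwd w + (∑[ p ++ s ≡ w ] ∑[ q ++ r ≡ s ] backwardPath p * (backwardPath q * pathCovers r))
  pathCovers-two-paths w = begin
    pathCovers w
      ≡⟨ pathCovers-split w ⟩
    𝟙ᵇ (null w) + (∑[ p ++ s ≡ w ] backwardPath p * pathCovers s)
      ≡⟨ cong (𝟙ᵇ (null w) +_) (∑-splits-cong w (λ p s →
           trans (cong (backwardPath p *_) (pathCovers-split s)) (*-distribˡ-+ (backwardPath p) _ _))) ⟩
    𝟙ᵇ (null w) + (∑[ p ++ s ≡ w ] (backwardPath p * 𝟙ᵇ (null s) + backwardPath p * rest s))
      ≡⟨ cong (𝟙ᵇ (null w) +_) (∑-splits-+ w _ _) ⟩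
    𝟙ᵇ (null w) + ((∑[ p ++ s ≡ w ] backwardPath p * 𝟙ᵇ (null s)) + paired)
      ≡⟨ cong (λ t → 𝟙ᵇ (null w) + (t + paired)) (∑-splits-null w backwardPath) ⟩
    𝟙ᵇ (null w) + (backwardPath w + paired)
      ≡⟨ +-assoc (𝟙ᵇ (null w)) _ _ ⟨
    (𝟙ᵇ (null w) + backwardPath w) + paired
      ≡⟨ cong₂ _+_ (single-path w) (∑-splits-cong w (λ p s → *-∑-splits s (λ _ → backwardPath p) _)) ⟩
    ∏-adjacent bwd w + (∑[ p ++ s ≡ w ] ∑[ q ++ r ≡ s ] backwardPath p * (backwardPath q * pathCovers r))
      ∎
    where
    open ≡-Reasoning
    rest : List (Fin n) → ℕ
    rest s = ∑[ q ++ r ≡ s ] backwardPath q * pathCovers r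
    paired : ℕ
    paired = ∑[ p ++ s ≡ w ] backwardPath p * rest s
    single-path : ∀ w → 𝟙ᵇ (null w) + backwardPath w ≡ ∏-adjacent bwd w
    single-path []      = refl
    single-path (_ ∷ _) = refl

  pairedPaths : List (Fin n) → List (Fin n) → List (Fin n) → ℕ
  pairedPaths p q r = isUnique (p ++ q ++ r) * (backwardPath p * (backwardPath q * pathCovers r))

  pairedPaths-swap : ∀ p q r → pairedPaths p q r ≡ pairedPaths q p r
  pairedPaths-swap p q r =
    cong₂ _*_ (isUnique-↭ (shifts p q)) (*-left-comm (backwardPath p) (backwardPath q) (pathCovers r))

  pairedPaths-diagonal : ∀ p r → pairedPaths p p r ≡ 0
  pairedPaths-diagonal []      r = *-zeroʳ (isUnique r)
  pairedPaths-diagonal (a ∷ p) r =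
    cong (_* (backwardPath (a ∷ p) * (backwardPath (a ∷ p) * pathCovers r))) (isUnique-repeat a p (p ++ r))

  isUnique-*-pathCovers : ∀ w → isUnique w * pathCovers w ≡
    isUnique w * ∏-adjacent bwd w + (∑[ p ++ s ≡ w ] ∑[ q ++ r ≡ s ] pairedPaths p q r)
  isUnique-*-pathCovers w =
    trans (cong (isUnique w *_) (pathCovers-two-paths w))
    (trans (*-distribˡ-+ (isUnique w) _ _)
    (cong (isUnique w * ∏-adjacent bwd w +_)
      (trans (*-∑-splits w isUnique _)
             (∑-splits-cong w (λ p s → *-∑-splits s (λ x → isUnique (p ++ x)) _)))))

  ∑-isUnique-*-backward≡N=∅ : ∑[ w ← allLists n n ] isUnique w * ∏-adjacent bwd w ≡ N=∅ G
  ∑-isUnique-*-backward≡N=∅ = sym (begin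
    N=∅ G
      ≡⟨ length-filter-permutations (allForward? G) ⟩
    ∑[ w ← allLists n n ] isUnique w * 𝟙 (allForward? G w)
      ≡⟨ ∑-cong (allLists n n) (λ w → cong (isUnique w *_) (𝟙-allForward? w)) ⟩
    ∑[ w ← allLists n n ] isUnique w * ∏-adjacent fwd w
      ≡⟨ ∑-allLists-reverse n (λ w → isUnique w * ∏-adjacent fwd w) ⟨
    ∑[ w ← allLists n n ] isUnique (reverse w) * ∏-adjacent fwd (reverse w)
      ≡⟨ ∑-cong (allLists n n) (λ w → cong₂ _*_ (isUnique-↭ (↭-reverse w)) (∏-adjacent-reverse fwd w)) ⟩
    ∑[ w ← allLists n n ] isUnique w * ∏-adjacent (flip fwd) w
      ≡⟨ ∑-cong (allLists n n) (λ w → 𝟙-*-cong (unique? w) (∏-adjacent-cong-≢ fwd-flip)) ⟩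
    ∑[ w ← allLists n n ] isUnique w * ∏-adjacent bwd w
      ∎)
    where
    open ≡-Reasoning
    open UniqueDec (_≟ᶠ_ {n}) using (unique?)

  parity-N∅≡parity-N=∅ : parity (N∅ G) ≡ parity (N=∅ G)
  parity-N∅≡parity-N=∅ = begin
    parity (N∅ G)
      ≡⟨ cong parity (length-filter-permutations (noReversed? G)) ⟩
    parity (∑[ w ← allLists n n ] isUnique w * 𝟙 (noReversed? G w))
      ≡⟨ parity-∑-cong (allLists n n) (λ w → trans (parity-* (isUnique w) _)
           (trans (cong (parity (isUnique w) ∧_) (trans (parity-𝟙 (noReversed? G w)) (sym (parity-pathCovers w))))
                  (sym (parity-* (isUnique w) _)))) ⟩
    parity (∑[ w ← allLists n n ] isUnique w * pathCovers w)
      ≡⟨ cong parity (trans (∑-cong (allLists n n) isUnique-*-pathCovers) (∑-+ (allLists n n) _ _)) ⟩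
    parity (singleSum + pairedSum)
      ≡⟨ parity-+ singleSum pairedSum ⟩
    parity singleSum xor parity pairedSum
      ≡⟨ cong₂ _xor_ (cong parity ∑-isUnique-*-backward≡N=∅)
           (parity-∑-allLists-splits²-symmetric n pairedPaths pairedPaths-swap pairedPaths-diagonal) ⟩
    parity (N=∅ G) xor false
      ≡⟨ xor-identityʳ _ ⟩
    parity (N=∅ G)
      ∎
    where
    open ≡-Reasoning
    singleSum : ℕ
    singleSum = ∑[ w ← allLists n n ] isUnique w * ∏-adjacent bwd w
    pairedSum : ℕ
    pairedSum = ∑[ w ← allLists n n ] ∑[ p ++ s ≡ w ] ∑[ q ++ r ≡ s ] pairedPaths p q r

  N∅≡N=∅+Nmixed : N∅ G ≡ N=∅ G + Nmixed G
  N∅≡N=∅+Nmixed = begin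
    N∅ G
      ≡⟨ length-filter-permutations (noReversed? G) ⟩
    ∑[ w ← allLists n n ] isUnique w * 𝟙 (noReversed? G w)
      ≡⟨ ∑-cong (allLists n n) (λ w →
           trans (cong (isUnique w *_) (partition w)) (*-distribˡ-+ (isUnique w) _ _)) ⟩
    ∑[ w ← allLists n n ]
      (isUnique w * 𝟙 (allForward? G w) + isUnique w * 𝟙 (someE₁₂? G w ×-dec noReversed? G w))
      ≡⟨ ∑-+ (allLists n n) _ _ ⟩
    (∑[ w ← allLists n n ] isUnique w * 𝟙 (allForward? G w))
      + (∑[ w ← allLists n n ] isUnique w * 𝟙 (someE₁₂? G w ×-dec noReversed? G w))
      ≡⟨ cong₂ _+_ (length-filter-permutations (allForward? G))
                   (length-filter-permutations (λ w → someE₁₂? G w ×-dec noReversed? G w)) ⟨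
    N=∅ G + Nmixed G
      ∎
    where
    open ≡-Reasoning
    partition : ∀ w → 𝟙 (noReversed? G w) ≡ 𝟙 (allForward? G w) + 𝟙 (someE₁₂? G w ×-dec noReversed? G w)
    partition w = 𝟙-partition (noReversed? G w) (allForward? G w) (someE₁₂? G w)
      (All.map forward⇒¬backward)
      (λ forwards → All¬⇒¬Any (All.map forward⇒¬E₁₂ forwards))
      (λ noBackward noE₁₂ → All.zipWith (λ (¬b , ¬e) → ¬backward⇒¬E₁₂⇒forward ¬b ¬e)
                               (noBackward , ¬Any⇒All¬ (adjPairs w) noE₁₂))

mainTheorem4 : (n : ℕ) → 2 ≤ n → (G : MixedGraph n) →
    (N∅ G % 2 ≡ N=∅ G % 2) × (2 ∣ Nmixed G)
mainTheorem4 n _ G =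
  parity≡⇒%2≡ (N∅ G) (N=∅ G) (parity-N∅≡parity-N=∅ G) ,
  parity≡false⇒2∣ (Nmixed G)
    (parity-+-cancelˡ (N=∅ G) (Nmixed G)
      (trans (cong parity (sym (N∅≡N=∅+Nmixed G))) (parity-N∅≡parity-N=∅ G)))
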